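{- Let $M$ be a loopless matroid of rank $d > 1$ on a finite set $E$ with rank function $r_M$, and let $N$ be its truncation, with rank function $r_N(S) := \min\{r_M(S), d-1\}$. Then for all $S \subseteq E$, \[ r'_N(S) = \min\{r'_M(S),\, 2d-3\}. \]
   Context: For a loopless matroid with rank function $\rho$ on $E$, define $\rho'(S) := \min \sum_{i=1}^k (2\rho(P_i)-1)$, the minimum over all partitions $\{P_1,\ldots,P_k\}$ of $S$ (pairwise disjoint nonempty subsets with union $S$). Here $r'_M$ and $r'_N$ are obtained in this way from $r_M$ and $r_N$. -}

module Defs where

open import Data.Nat using (ℕ; _+_; _*_; _∸_; _≤_; _⊓_)
open import Data.Fin.Subset using (Subset; ⊥; ⊤; ⁅_⁆; _⊆_; _∩_; _∪_; ⋃; ∣_∣; Nonempty)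
open import Data.Fin using (Fin)
open import Data.List using (List; map)
open import Data.Nat.ListAction using (sum)
open import Data.List.Relation.Unary.All using (All)
open import Data.List.Relation.Unary.AllPairs using (AllPairs)
open import Data.Product using (_×_; Σ)
open import Relation.Binary.PropositionalEquality using (_≡_)

record IsMatroidRank (n : ℕ) (r : Subset n → ℕ) : Set where
  field
    bounded    : ∀ S → r S ≤ ∣ S ∣
    monotone   : ∀ {S T} → S ⊆ T → r S ≤ r T
    submodular : ∀ S T → r (S ∪ T) + r (S ∩ T) ≤ r S + r T

Loopless : ∀ {n} → (Subset n → ℕ) → Set
Loopless {n} r = ∀ (e : Fin n) → r ⁅ e ⁆ ≡ 1

rankOf : ∀ {n} → (Subset n → ℕ) → ℕ
rankOf r = r ⊤

truncation : ∀ {n} → (Subset n → ℕ) → (Subset n → ℕ)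
truncation r S = r S ⊓ (rankOf r ∸ 1)

IsPartition : ∀ {n} → Subset n → List (Subset n) → Set
IsPartition S Ps =
  All Nonempty Ps × AllPairs (λ A B → A ∩ B ≡ ⊥) Ps × ⋃ Ps ≡ S

partitionValue : ∀ {n} → (Subset n → ℕ) → List (Subset n) → ℕ
partitionValue ρ Ps = sum (map (λ P → 2 * ρ P ∸ 1) Ps)

IsRho' : ∀ {n} → (Subset n → ℕ) → Subset n → ℕ → Set
IsRho' ρ S v =
  Σ (List (Subset _)) (λ Ps → IsPartition S Ps × partitionValue ρ Ps ≡ v)
  × (∀ Ps → IsPartition S Ps → v ≤ partitionValue ρ Ps)

{-# OPTIONS --safe #-}
module Submission where

open import Defs
open import Data.Nat using (ℕ; _*_; _∸_; _≤_; _⊓_; _+_; z≤n; _≤?_)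
open import Data.Nat.Properties
open import Data.Fin.Subset using (Subset)
open import Data.Fin.Subset.Properties using (nonempty?; Empty-unique; ∪-identityʳ)
open import Data.List using (List; []; _∷_; length)
open import Data.List.Relation.Unary.All using ([]; _∷_)
open import Data.List.Relation.Unary.AllPairs using ([]; _∷_)
open import Data.Product using (Σ; _×_; _,_)
open import Relation.Nullary using (yes; no)
open import Relation.Binary.PropositionalEquality using (_≡_; sym; cong; subst; module ≡-Reasoning)

-- Capping every rank at m caps every term 2ρ(P) - 1 at 2m - 1. Hence a partition's
-- value for the capped function lies between min(value, 2m - 1) and the value itself,
-- and the one-block partition {S} has capped value at most 2m - 1. Nothing about
-- matroids is used: the identity holds for every ρ.

+-⊓-subadditive : ∀ a b c → (a + b) ⊓ c ≤ a ⊓ c + b ⊓ c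
+-⊓-subadditive a b c with a ≤? c
... | yes a≤c = begin
  (a + b) ⊓ c      ≤⟨ ⊓-monoʳ-≤ (a + b) (m≤n+m c a) ⟩
  (a + b) ⊓ (a + c) ≡⟨ +-distribˡ-⊓ a b c ⟨
  a + b ⊓ c        ≡⟨ cong (_+ b ⊓ c) (m≤n⇒m⊓n≡m a≤c) ⟨
  a ⊓ c + b ⊓ c    ∎
  where open ≤-Reasoning
... | no a≰c = begin
  (a + b) ⊓ c   ≤⟨ m⊓n≤n (a + b) c ⟩
  c             ≤⟨ m≤m+n c (b ⊓ c) ⟩
  c + b ⊓ c     ≡⟨ cong (_+ b ⊓ c) (m≥n⇒m⊓n≡n (<⇒≤ (≰⇒> a≰c))) ⟨
  a ⊓ c + b ⊓ c ∎
  where open ≤-Reasoning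

2*-∸1-distrib-⊓ : ∀ x m → 2 * (x ⊓ m) ∸ 1 ≡ (2 * x ∸ 1) ⊓ (2 * m ∸ 1)
2*-∸1-distrib-⊓ x m = begin
  2 * (x ⊓ m) ∸ 1         ≡⟨ cong (_∸ 1) (*-distribˡ-⊓ 2 x m) ⟩
  (2 * x) ⊓ (2 * m) ∸ 1   ≡⟨ ∸-distribʳ-⊓ 1 (2 * x) (2 * m) ⟩
  (2 * x ∸ 1) ⊓ (2 * m ∸ 1) ∎
  where open ≡-Reasoning

2*[m∸1]∸1≡2*m∸3 : ∀ m → 2 * (m ∸ 1) ∸ 1 ≡ 2 * m ∸ 3
2*[m∸1]∸1≡2*m∸3 m = begin
  2 * (m ∸ 1) ∸ 1   ≡⟨ cong (_∸ 1) (*-distribˡ-∸ 2 m 1) ⟩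
  2 * m ∸ 2 ∸ 1     ≡⟨ ∸-+-assoc (2 * m) 2 1 ⟩
  2 * m ∸ 3         ∎
  where open ≡-Reasoning

module _ {n : ℕ} (ρ : Subset n → ℕ) (m : ℕ) where

  capped : Subset n → ℕ
  capped S = ρ S ⊓ m

  partitionValue-capped-≤ : ∀ Ps → partitionValue capped Ps ≤ partitionValue ρ Ps
  partitionValue-capped-≤ []       = ≤-refl
  partitionValue-capped-≤ (P ∷ Ps) =
    +-mono-≤ (∸-monoˡ-≤ 1 (*-monoʳ-≤ 2 (m⊓n≤m (ρ P) m))) (partitionValue-capped-≤ Ps)

  partitionValue-⊓-≤-capped :
    ∀ Ps → partitionValue ρ Ps ⊓ (2 * m ∸ 1) ≤ partitionValue capped Ps
  partitionValue-⊓-≤-capped []       = m⊓n≤m 0 (2 * m ∸ 1)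
  partitionValue-⊓-≤-capped (P ∷ Ps) = begin
    (2 * ρ P ∸ 1 + partitionValue ρ Ps) ⊓ c
      ≤⟨ +-⊓-subadditive (2 * ρ P ∸ 1) (partitionValue ρ Ps) c ⟩
    (2 * ρ P ∸ 1) ⊓ c + partitionValue ρ Ps ⊓ c
      ≤⟨ +-monoʳ-≤ ((2 * ρ P ∸ 1) ⊓ c) (partitionValue-⊓-≤-capped Ps) ⟩
    (2 * ρ P ∸ 1) ⊓ c + partitionValue capped Ps
      ≡⟨ cong (_+ partitionValue capped Ps) (2*-∸1-distrib-⊓ (ρ P) m) ⟨
    2 * capped P ∸ 1 + partitionValue capped Ps
      ∎
    where
    open ≤-Reasoning
    c = 2 * m ∸ 1

  partitionValue-capped-≤-length :
    ∀ Ps → partitionValue capped Ps ≤ length Ps * (2 * m ∸ 1)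
  partitionValue-capped-≤-length []       = z≤n
  partitionValue-capped-≤-length (P ∷ Ps) =
    +-mono-≤ (∸-monoˡ-≤ 1 (*-monoʳ-≤ 2 (m⊓n≤n (ρ P) m)))
             (partitionValue-capped-≤-length Ps)

coarsestPartition : ∀ {n} (S : Subset n) →
                    Σ (List (Subset n)) λ Ps → IsPartition S Ps × length Ps ≤ 1
coarsestPartition S with nonempty? S
... | yes S≠∅ = S ∷ [] , (S≠∅ ∷ [] , [] ∷ [] , ∪-identityʳ S) , ≤-refl
... | no  S=∅ = [] , ([] , [] , sym (Empty-unique S=∅)) , z≤n

IsRho'-intro : ∀ {n} (ρ : Subset n → ℕ) S v →
               Σ (List (Subset n)) (λ Ps → IsPartition S Ps × partitionValue ρ Ps ≤ v) →
               (∀ Ps → IsPartition S Ps → v ≤ partitionValue ρ Ps) →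
               IsRho' ρ S v
IsRho'-intro ρ S v (Ps , part , value≤v) minimal =
  (Ps , part , ≤-antisym value≤v (minimal Ps part)) , minimal

IsRho'-capped : ∀ {n} (ρ : Subset n → ℕ) m S v → IsRho' ρ S v →
                IsRho' (capped ρ m) S (v ⊓ (2 * m ∸ 1))
IsRho'-capped ρ m S v ((Ps , part , value≡v) , minimal) =
  IsRho'-intro (capped ρ m) S (v ⊓ c) attained lower
  where
  c = 2 * m ∸ 1
  lower : ∀ Qs → IsPartition S Qs → v ⊓ c ≤ partitionValue (capped ρ m) Qs
  lower Qs part′ =
    ≤-trans (⊓-monoˡ-≤ c (minimal Qs part′)) (partitionValue-⊓-≤-capped ρ m Qs)
  attained : Σ (List (Subset _)) λ Qs →
             IsPartition S Qs × partitionValue (capped ρ m) Qs ≤ v ⊓ c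
  attained with v ≤? c
  ... | yes v≤c = Ps , part , (begin
    partitionValue (capped ρ m) Ps ≤⟨ partitionValue-capped-≤ ρ m Ps ⟩
    partitionValue ρ Ps            ≡⟨ value≡v ⟩
    v                              ≡⟨ m≤n⇒m⊓n≡m v≤c ⟨
    v ⊓ c                          ∎)
    where open ≤-Reasoning
  ... | no v≰c with coarsestPartition S
  ...   | Qs , part′ , length≤1 = Qs , part′ , (begin
    partitionValue (capped ρ m) Qs ≤⟨ partitionValue-capped-≤-length ρ m Qs ⟩
    length Qs * c                  ≤⟨ *-monoˡ-≤ c length≤1 ⟩
    1 * c                          ≡⟨ *-identityˡ c ⟩
    c                              ≡⟨ m≥n⇒m⊓n≡n (<⇒≤ (≰⇒> v≰c)) ⟨
    v ⊓ c                          ∎)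
    where open ≤-Reasoning

lemma3p3 : ∀ (n : ℕ) (r : Subset n → ℕ) → IsMatroidRank n r → Loopless r
           → 2 ≤ rankOf r
           → ∀ (S : Subset n) (v : ℕ) → IsRho' r S v
           → IsRho' (truncation r) S (v ⊓ (2 * rankOf r ∸ 3))
lemma3p3 n r _ _ _ S v ρ′ =
  subst (IsRho' (truncation r) S) (cong (v ⊓_) (2*[m∸1]∸1≡2*m∸3 (rankOf r)))
        (IsRho'-capped r (rankOf r ∸ 1) S v ρ′)
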